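{- For every positive integer $k$, the set $\mathcal{L}_k$ of all $L_k$-overpartitions is a separable overpartition class.
   Context: Overpartitions here are partitions (non-increasing sequences of positive integers) in which the last occurrence of each distinct part value may be overlined; for a positive integer $c$ and nonnegative integer $d$, $\overline c+d=\overline{c+d}$. An $L_k$-overpartition is an overpartition $\pi=(\pi_1,\ldots,\pi_\ell)$ such that whenever $\pi_i$ is overlined, $\ell-i\equiv0\pmod k$. A set $\mathcal{P}$ of overpartitions is a separable overpartition class if there is a subset $\mathcal{B}\subset\mathcal{P}$ (the basis) such that for each $m\ge1$ the number of overpartitions in $\mathcal{B}$ with $m$ parts is finite, every overpartition in $\mathcal{P}$ with $m$ parts is uniquely of the form $(\lambda_1+\mu_1,\lambda_2+\mu_2,\ldots,\lambda_m+\mu_m)$ with $(\lambda_1,\ldots,\lambda_m)\in\mathcal{B}$ and $(\mu_1,\ldots,\mu_m)$ a non-increasing sequence of nonnegative integers, and all overpartitions of this form lie in $\mathcal{P}$. -}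

module Defs where

open import Data.Nat using (ℕ; _+_; _≤_; _<_; _≥_)
open import Data.Nat.Divisibility using (_∣_)
open import Data.Bool using (Bool; true)
open import Data.Product using (_×_; _,_; proj₁; Σ; ∃)
open import Data.Unit using (⊤)
open import Data.List using (List; []; _∷_; length; zipWith)
open import Data.List.Relation.Unary.All using (All)
open import Data.List.Relation.Unary.Linked using (Linked)
open import Data.List.Membership.Propositional using (_∈_)
open import Relation.Binary.PropositionalEquality using (_≡_)

-- A part of an overpartition: its value and whether it is overlined.
Part : Set
Part = ℕ × Bool

OP : Set
OP = List Part

-- Relation between consecutive parts πᵢ, πᵢ₊₁: non-increasing values, and an
-- overlined part must be the last occurrence of its value (so πᵢ₊₁ < πᵢ).
Step : Part → Part → Set
Step (v , b) (w , c) = (w ≤ v) × (b ≡ true → w < v)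

IsOverpartition : OP → Set
IsOverpartition π = Linked Step π × All (λ p → 1 ≤ proj₁ p) π

-- Lk-condition: whenever πᵢ is overlined, ℓ - i ≡ 0 (mod k);
-- ℓ - i is the number of parts after πᵢ.
LkCond : ℕ → OP → Set
LkCond k [] = ⊤
LkCond k ((v , b) ∷ rest) = (b ≡ true → k ∣ length rest) × LkCond k rest

IsLkOverpartition : ℕ → OP → Set
IsLkOverpartition k π = IsOverpartition π × LkCond k π

-- (λ₁+μ₁, …, λ_m+μ_m), with c̄ + d = \overline{c+d}.
addParts : OP → List ℕ → OP
addParts = zipWith (λ p n → (proj₁ p + n , Data.Product.proj₂ p))

NonIncreasing : List ℕ → Set
NonIncreasing = Linked _≥_

Decomp : (OP → Set) → ℕ → OP → List ℕ → Set
Decomp 𝓑 m lam mu = 𝓑 lam × length lam ≡ m × length mu ≡ m × NonIncreasing mu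

SeparableClass : (OP → Set) → Set₁
SeparableClass 𝓟 =
  Σ (OP → Set) λ 𝓑 →
    (∀ π → 𝓑 π → 𝓟 π)
    × (∀ m → 1 ≤ m → ∃ λ (L : List OP) → ∀ lam → 𝓑 lam → length lam ≡ m → lam ∈ L)
    × (∀ m → 1 ≤ m → ∀ π → 𝓟 π → length π ≡ m →
         Σ OP λ lam → Σ (List ℕ) λ mu →
           Decomp 𝓑 m lam mu × π ≡ addParts lam mu
           × (∀ lam′ mu′ → Decomp 𝓑 m lam′ mu′ → π ≡ addParts lam′ mu′ →
                lam′ ≡ lam × mu′ ≡ mu))
    × (∀ m → 1 ≤ m → ∀ lam mu → Decomp 𝓑 m lam mu → 𝓟 (addParts lam mu))

{-# OPTIONS --safe #-}
-- Adding a non-increasing sequence to an overpartition keeps its number of parts and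
-- its overline pattern, and the L_k condition depends on nothing else. An overlined
-- part must exceed the next part by at least 1, a non-overlined one by at least 0, so
-- among the overpartitions with overline pattern b₁ … b_m there is a least one,
-- λᵢ = 1 + #{ i ≤ j < m : bⱼ overlined }. Every π with that pattern dominates it, and
-- the excess πᵢ − λᵢ is non-increasing because πᵢ − πᵢ₊₁ ≥ [bᵢ] = λᵢ − λᵢ₊₁. Hence the
-- least L_k-overpartitions, at most 2^m of them with m parts, form a basis.
module Submission where

open import Defs
open import Data.Bool using (Bool; true; false)
open import Data.List using (List; []; _∷_; length; map; _++_)
open import Data.List.Properties using (∷-injective; length-map)
open import Data.List.Membership.Propositional using (_∈_)
open import Data.List.Membership.Propositional.Properties using (∈-map⁺; ∈-++⁺ˡ; ∈-++⁺ʳ)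
open import Data.List.Relation.Unary.All using (All; []; _∷_)
open import Data.List.Relation.Unary.Any using (here)
open import Data.List.Relation.Unary.Linked using (Linked; []; [-]; _∷_)
import Data.List.Relation.Unary.Linked as Linked
open import Data.Nat using (ℕ; zero; suc; _+_; _∸_; _≤_)
open import Data.Nat.Divisibility using (_∣_)
open import Data.Nat.Properties
open import Data.Product using (_×_; _,_; proj₁; proj₂)
open import Data.Unit using (tt)
open import Function using (_∘_)
open import Relation.Binary.PropositionalEquality
open ≡-Reasoning

flags : OP → List Bool
flags = map proj₂

Positive : OP → Set
Positive = All (λ p → 1 ≤ proj₁ p)

toℕ : Bool → ℕ
toℕ true  = 1
toℕ false = 0

least : Bool → List Bool → ℕ
least _ []       = 1
least b (c ∷ bs) = toℕ b + least c bs

minimal : List Bool → OP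
minimal []       = []
minimal (b ∷ bs) = (least b bs , b) ∷ minimal bs

IsMinimal : OP → Set
IsMinimal lam = lam ≡ minimal (flags lam)

excess : OP → List ℕ
excess []            = []
excess ((v , b) ∷ π) = (v ∸ least b (flags π)) ∷ excess π

Basis : ℕ → OP → Set
Basis k lam = IsLkOverpartition k lam × IsMinimal lam

length-≡-flags : ∀ {π π′ : OP} → flags π ≡ flags π′ → length π ≡ length π′
length-≡-flags {π} {π′} eq = begin
  length π            ≡⟨ length-map proj₂ π ⟨
  length (flags π)    ≡⟨ cong length eq ⟩
  length (flags π′)   ≡⟨ length-map proj₂ π′ ⟩
  length π′           ∎

LkCond-flags : ∀ k {π π′ : OP} → flags π ≡ flags π′ → LkCond k π → LkCond k π′
LkCond-flags k {[]}    {[]}     _  _          = tt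
LkCond-flags k {_ ∷ π} {_ ∷ π′} eq (lk , lks) with ∷-injective eq
... | refl , eq′ = (λ b → subst (k ∣_) (length-≡-flags eq′) (lk b)) , LkCond-flags k eq′ lks

flags-addParts : ∀ (lam : OP) mu → length lam ≡ length mu → flags (addParts lam mu) ≡ flags lam
flags-addParts []              []       _  = refl
flags-addParts ((_ , b) ∷ lam) (_ ∷ mu) eq = cong (b ∷_) (flags-addParts lam mu (suc-injective eq))

addParts-cancelˡ : ∀ (lam : OP) mu mu′ → length mu ≡ length lam → length mu′ ≡ length lam →
                   addParts lam mu ≡ addParts lam mu′ → mu ≡ mu′
addParts-cancelˡ []              []       []         _  _  _   = refl
addParts-cancelˡ ((a , _) ∷ lam) (x ∷ mu) (x′ ∷ mu′) eq eq′ sum with ∷-injective sum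
... | head , tail =
  cong₂ _∷_ (+-cancelˡ-≡ a x x′ (cong proj₁ head))
            (addParts-cancelˡ lam mu mu′ (suc-injective eq) (suc-injective eq′) tail)

addParts-linked : ∀ (lam : OP) mu → length lam ≡ length mu →
                  Linked Step lam → NonIncreasing mu → Linked Step (addParts lam mu)
addParts-linked []       []       _  _ _ = []
addParts-linked (_ ∷ []) (_ ∷ []) _  _ _ = [-]
addParts-linked (_ ∷ p ∷ lam) (_ ∷ y ∷ mu) eq ((≤v , <v) ∷ ls) (y≤x ∷ ms) =
  (+-mono-≤ ≤v y≤x , λ b → +-mono-<-≤ (<v b) y≤x)
  ∷ addParts-linked (p ∷ lam) (y ∷ mu) (suc-injective eq) ls ms

addParts-positive : ∀ (lam : OP) mu → length lam ≡ length mu → Positive lam → Positive (addParts lam mu)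
addParts-positive []              []       _  _          = []
addParts-positive ((a , _) ∷ lam) (x ∷ mu) eq (a≥1 ∷ ps) =
  ≤-trans a≥1 (m≤m+n a x) ∷ addParts-positive lam mu (suc-injective eq) ps

addParts-LkOverpartition : ∀ k (lam : OP) mu → length lam ≡ length mu →
                           IsLkOverpartition k lam → NonIncreasing mu →
                           IsLkOverpartition k (addParts lam mu)
addParts-LkOverpartition k lam mu eq ((ls , ps) , lks) ms =
  (addParts-linked lam mu eq ls ms , addParts-positive lam mu eq ps)
  , LkCond-flags k (sym (flags-addParts lam mu eq)) lks

flags-minimal : ∀ bs → flags (minimal bs) ≡ bs
flags-minimal []       = refl
flags-minimal (b ∷ bs) = cong (b ∷_) (flags-minimal bs)

minimal-isMinimal : ∀ bs → IsMinimal (minimal bs)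
minimal-isMinimal bs = cong minimal (sym (flags-minimal bs))

least-positive : ∀ b bs → 1 ≤ least b bs
least-positive _ []       = ≤-refl
least-positive b (c ∷ bs) = ≤-trans (least-positive c bs) (m≤n+m _ (toℕ b))

minimal-isOverpartition : ∀ bs → IsOverpartition (minimal bs)
minimal-isOverpartition bs = linked bs , positive bs
  where
  linked : ∀ bs → Linked Step (minimal bs)
  linked []           = []
  linked (_ ∷ [])     = [-]
  linked (b ∷ c ∷ bs) = (m≤n+m _ (toℕ b) , λ { refl → ≤-refl }) ∷ linked (c ∷ bs)

  positive : ∀ bs → Positive (minimal bs)
  positive []       = []
  positive (b ∷ bs) = least-positive b bs ∷ positive bs

step-gap : ∀ {v b w c} → Step (v , b) (w , c) → toℕ b + w ≤ v
step-gap {b = true}  (_ , w<v) = w<v refl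
step-gap {b = false} (w≤v , _) = w≤v

least-≤-head : ∀ v b (π : OP) → IsOverpartition ((v , b) ∷ π) → least b (flags π) ≤ v
least-≤-head _ _ []            (_ , v≥1 ∷ _)    = v≥1
least-≤-head v b ((w , c) ∷ π) (s ∷ ls , _ ∷ ps) =
  ≤-trans (+-monoʳ-≤ (toℕ b) (least-≤-head w c π (ls , ps))) (step-gap {c = c} s)

addParts-minimal-excess : ∀ π → IsOverpartition π → π ≡ addParts (minimal (flags π)) (excess π)
addParts-minimal-excess []            _                 = refl
addParts-minimal-excess ((v , b) ∷ π) op@(ls , _ ∷ ps) =
  cong₂ _∷_ (cong (_, b) (sym (m+[n∸m]≡n (least-≤-head v b π op))))
            (addParts-minimal-excess π (Linked.tail ls , ps))

excess-nonIncreasing : ∀ π → Linked Step π → NonIncreasing (excess π)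
excess-nonIncreasing []       _ = []
excess-nonIncreasing (_ ∷ []) _ = [-]
excess-nonIncreasing ((v , b) ∷ (w , c) ∷ π) (s ∷ ls) =
  ≤-trans (∸-monoˡ-≤ h w≤v∸b) (≤-reflexive (∸-+-assoc v (toℕ b) h))
  ∷ excess-nonIncreasing ((w , c) ∷ π) ls
  where
  h = least c (flags π)
  w≤v∸b : w ≤ v ∸ toℕ b
  w≤v∸b = m+n≤o⇒m≤o∸n w (≤-trans (≤-reflexive (+-comm w (toℕ b))) (step-gap {c = c} s))

length-excess : ∀ π → length (excess π) ≡ length π
length-excess []      = refl
length-excess (_ ∷ π) = cong suc (length-excess π)

Decomp-minimal-excess : ∀ k π → IsLkOverpartition k π →
                        Decomp (Basis k) (length π) (minimal (flags π)) (excess π)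
Decomp-minimal-excess k π (op@(ls , _) , lks) =
  ( (minimal-isOverpartition (flags π) , LkCond-flags k (sym (flags-minimal (flags π))) lks)
  , minimal-isMinimal (flags π) )
  , length-≡-flags (flags-minimal (flags π))
  , length-excess π
  , excess-nonIncreasing π ls

addParts-injective : ∀ {lam mu lam′ mu′} → IsMinimal lam → IsMinimal lam′ →
                     length lam ≡ length mu → length lam′ ≡ length mu′ → length mu ≡ length mu′ →
                     addParts lam mu ≡ addParts lam′ mu′ → lam ≡ lam′ × mu ≡ mu′
addParts-injective {lam} {mu} {lam′} {mu′} min min′ len len′ lenμ sum with lam≡lam′
  where
  lam≡lam′ : lam ≡ lam′
  lam≡lam′ = begin
    lam                                  ≡⟨ min ⟩
    minimal (flags lam)                  ≡⟨ cong minimal (flags-addParts lam mu len) ⟨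
    minimal (flags (addParts lam mu))    ≡⟨ cong (minimal ∘ flags) sum ⟩
    minimal (flags (addParts lam′ mu′))  ≡⟨ cong minimal (flags-addParts lam′ mu′ len′) ⟩
    minimal (flags lam′)                 ≡⟨ min′ ⟨
    lam′                                 ∎
... | refl = refl , addParts-cancelˡ lam mu mu′ (sym len) (trans (sym lenμ) (sym len)) sum

Decomp-unique : ∀ k {m lam mu lam′ mu′} → Decomp (Basis k) m lam mu → Decomp (Basis k) m lam′ mu′ →
                addParts lam mu ≡ addParts lam′ mu′ → lam ≡ lam′ × mu ≡ mu′
Decomp-unique k ((_ , min) , lam≡m , mu≡m , _) ((_ , min′) , lam′≡m , mu′≡m , _) =
  addParts-injective min min′ (trans lam≡m (sym mu≡m)) (trans lam′≡m (sym mu′≡m)) (trans mu≡m (sym mu′≡m))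

boolLists : ℕ → List (List Bool)
boolLists zero    = [] ∷ []
boolLists (suc m) = map (true ∷_) (boolLists m) ++ map (false ∷_) (boolLists m)

∈-boolLists : ∀ bs → bs ∈ boolLists (length bs)
∈-boolLists []           = here refl
∈-boolLists (true ∷ bs)  = ∈-++⁺ˡ (∈-map⁺ (true ∷_) (∈-boolLists bs))
∈-boolLists (false ∷ bs) = ∈-++⁺ʳ (map (true ∷_) (boolLists (length bs))) (∈-map⁺ (false ∷_) (∈-boolLists bs))

minimal-finite : ∀ lam → IsMinimal lam → lam ∈ map minimal (boolLists (length lam))
minimal-finite lam min =
  subst (_∈ map minimal (boolLists (length lam))) (sym min)
    (∈-map⁺ minimal (subst (λ n → flags lam ∈ boolLists n) (length-map proj₂ lam) (∈-boolLists (flags lam))))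

lemma3p2 : (k : ℕ) → 1 ≤ k → SeparableClass (IsLkOverpartition k)
lemma3p2 k _ =
  Basis k
  , (λ _ → proj₁)
  , (λ m _ → map minimal (boolLists m) , λ { lam (_ , min) refl → minimal-finite lam min })
  , (λ { m _ π π-Lk refl →
         let decomp = Decomp-minimal-excess k π π-Lk
             π≡sum  = addParts-minimal-excess π (proj₁ π-Lk)
         in minimal (flags π) , excess π , decomp , π≡sum
            , λ _ _ decomp′ π≡sum′ → Decomp-unique k decomp′ decomp (trans (sym π≡sum′) π≡sum) })
  , (λ { _ _ lam mu (lam-Lk , lam≡m , mu≡m , mu↓) →
         addParts-LkOverpartition k lam mu (trans lam≡m (sym mu≡m)) (proj₁ lam-Lk) mu↓ })
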